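{- Let $u_1,\dots,u_{2m}\in\{0,1\}^n$ and consider the complete graph on $\{u_1,\dots,u_{2m}\}$ with edge weights $|u_i\vee u_j|$. Then there exists a minimum-weight perfect matching of this graph that contains the maximum possible number (over all perfect matchings) of identical pairs, i.e., pairs $\{u_i,u_j\}$ with $u_i=u_j$. In particular this holds for the phase-1 graph $G$ of algorithm $A$ (on the $4k$ input vectors) and for the phase-2 graph $G'$ (on the vectors $v'_1,\dots,v'_{2k}$, where $v'_i$ is the component-wise maximum of the two vectors in the $i$-th pair of the phase-1 matching).
   Context: For $u,v\in\{0,1\}^n$: $u\vee v$ is the component-wise maximum and $|u|=\sum_\ell u_\ell$. Algorithm $A$ for partitioning $4k$ vectors into quads: phase 1 computes a minimum-weight perfect matching of the complete graph $G$ on the $4k$ vectors with weights $|v_i\vee v_j|$, giving pairs $p_1,\dots,p_{2k}$ with $v'_i$ the component-wise maximum of $p_i$; phase 2 computes a minimum-weight perfect matching of the complete graph $G'$ on the pairs with weights $|v'_i\vee v'_j|$. -}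

module Defs where

open import Data.Nat using (ℕ; zero; suc; _+_; _<?_)
open import Data.Bool using (Bool; true; false; _∨_; if_then_else_)
open import Data.Fin using (Fin; toℕ)
open import Data.Fin.Properties as FinP using ()
open import Data.Vec using (Vec; zipWith; count)
open import Data.Vec.Properties using (≡-dec)
open import Data.List using (List; allFin; map)
open import Data.Nat.ListAction using (sum)
open import Data.Product using (Σ; _×_; _,_; proj₁)
open import Relation.Binary.PropositionalEquality using (_≡_; _≢_)
open import Relation.Nullary using (Dec; yes; no; does)
import Data.Bool.Properties as BoolP

BVec : ℕ → Set
BVec n = Vec Bool n

_⊔v_ : ∀ {n} → BVec n → BVec n → BVec n
u ⊔v v = zipWith _∨_ u v

∣_∣v : ∀ {n} → BVec n → ℕ
∣ u ∣v = count (λ b → b BoolP.≟ true) u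

Σfin : (N : ℕ) → (Fin N → ℕ) → ℕ
Σfin N f = sum (map f (allFin N))

-- A perfect matching of the complete graph on vertex set Fin N, given as a
-- fixed-point-free involution (each vertex is sent to its partner).
PerfectMatching : ℕ → Set
PerfectMatching N =
  Σ (Fin N → Fin N) λ p → ((i : Fin N) → p (p i) ≡ i) × ((i : Fin N) → p i ≢ i)

partner : ∀ {N} → PerfectMatching N → Fin N → Fin N
partner = proj₁

-- each edge {i, p i} is counted once, at its smaller endpoint
edgeSum : ∀ {N} → PerfectMatching N → (Fin N → Fin N → ℕ) → ℕ
edgeSum {N} M w =
  Σfin N λ i → if does (toℕ i <? toℕ (partner M i)) then w i (partner M i) else 0

weight : ∀ {n N} → (Fin N → BVec n) → PerfectMatching N → ℕ
weight u M = edgeSum M λ i j → ∣ u i ⊔v u j ∣v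

identicalPairs : ∀ {n N} → (Fin N → BVec n) → PerfectMatching N → ℕ
identicalPairs u M =
  edgeSum M λ i j → if does (≡-dec BoolP._≟_ (u i) (u j)) then 1 else 0

module Submission where

open import Defs
open import Data.Bool using (true; false; if_then_else_)
import Data.Bool.Properties as Boolₚ
open import Data.Fin as Fin using (Fin; zero; suc; toℕ)
import Data.Fin.Induction as Finᵢ
import Data.Fin.Properties as Finₚ
open import Data.Fin.Permutation using (Permutation; permutation; _⟨$⟩ʳ_; _⟨$⟩ˡ_; inverseˡ; inverseʳ)
import Data.Fin.Permutation as Perm
open import Data.Fin.Permutation.Components using (transpose)
open import Data.List using (List; []; _∷_; map; allFin; tabulate; cartesianProductWith; mapMaybe; filter)
open import Data.List.Extrema.Nat using (argmin; argmax; f[argmin]≤v⁺; v≤f[argmax]⁺; argmax-all)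
open import Data.List.Membership.Propositional using (_∈_; _∉_; find; lose)
open import Data.List.Membership.Propositional.Properties using (∈-allFin; ∈-cartesianProductWith⁺; ∈-filter⁺)
open import Data.List.Properties using (map-tabulate; map-cong; map-cong-local)
open import Data.List.Relation.Unary.All as All using ([]; _∷_)
open import Data.List.Relation.Unary.All.Properties using (all-filter)
open import Data.List.Relation.Unary.Any as Any using (Any; here; there)
import Data.List.Relation.Unary.Any.Properties as Anyₚ
open import Data.List.Relation.Unary.Unique.Propositional using (Unique; []; _∷_)
open import Data.Maybe using (Maybe; just; nothing)
import Data.Maybe.Relation.Unary.Any as Maybe
open import Data.Nat using (ℕ; zero; suc; _+_; _*_; _≤_; _<_; z≤n; s≤s)
open import Data.Nat.ListAction using () renaming (sum to sumˡ)
open import Data.Nat.Properties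
open import Algebra.Properties.Semiring.Sum +-*-semiring
  using (sum; sum-cong-≗; ∑-distrib-+; ∑-comm; sum-permute; *-distribˡ-sum)
open import Data.Nat.Solver using (module +-*-Solver)
open import Data.Product using (Σ; _×_; _,_; proj₁; proj₂)
open import Data.Sum using (inj₁; inj₂)
open import Data.Vec using (Vec; []; _∷_; lookup) renaming (tabulate to tabulateᵛ)
open import Data.Vec.Functional using (Vector; updateAt)
open import Data.Vec.Functional.Properties using (updateAt-updates; updateAt-minimal)
open import Data.Vec.Properties using (lookup∘tabulate; zipWith-comm; zipWith-idem; ≡-dec)
open import Function using (_∘_; const)
open import Induction.WellFounded using (Acc; acc)
open import Relation.Binary using (DecidableEquality; tri<; tri≈; tri>)
open import Relation.Binary.PropositionalEquality
open import Relation.Nullary using (Dec; yes; no; does; ¬_; ¬?; contradiction)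
open import Relation.Nullary.Decidable using (dec-true; dec-false; _×-dec_; _→-dec_)
open +-*-Solver using (solve; _:+_; _:*_; _:=_; con)

-- Among the minimum-weight perfect matchings take one, M, with the most identical pairs.
-- If two distinct vertices i, j with u i = u j were both matched to vertices of another
-- value, re-pairing {i, p i}, {j, p j} as {i, j}, {p i, p j} (p the partner map of M)
-- would create an identical pair without increasing the weight, because
-- |x| + |a ∨ b| ≤ |x ∨ a| + |x ∨ b|. So in M every class of equal vectors has at most one
-- vertex matched outside the class. In any perfect matching the number of such vertices
-- of a class has the parity of the class size, hence M minimises their total, i.e.
-- maximises the number of identical pairs.

-- Finite sums

Σfin≡sum : ∀ N (f : Vector ℕ N) → Σfin N f ≡ sum f
Σfin≡sum N f = trans (cong sumˡ (map-tabulate (λ i → i) f)) (sumˡ-tabulate N f)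
  where
  sumˡ-tabulate : ∀ N (f : Vector ℕ N) → sumˡ (tabulate f) ≡ sum f
  sumˡ-tabulate zero    f = refl
  sumˡ-tabulate (suc N) f = cong (f zero +_) (sumˡ-tabulate N (f ∘ suc))

sum-mono-≤ : ∀ {N} {f g : Vector ℕ N} → (∀ i → f i ≤ g i) → sum f ≤ sum g
sum-mono-≤ {zero}  f≤g = z≤n
sum-mono-≤ {suc N} f≤g = +-mono-≤ (f≤g zero) (sum-mono-≤ (f≤g ∘ suc))

sum-zero : ∀ {N} {f : Vector ℕ N} → (∀ i → f i ≡ 0) → sum f ≡ 0
sum-zero {zero}  f≡0 = refl
sum-zero {suc N} f≡0 = cong₂ _+_ (f≡0 zero) (sum-zero (f≡0 ∘ suc))

sum-const-1 : ∀ N → sum {N} (const 1) ≡ N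
sum-const-1 zero    = refl
sum-const-1 (suc N) = cong suc (sum-const-1 N)

sum-∘-involution : ∀ {N} (p : Fin N → Fin N) → (∀ i → p (p i) ≡ i) → (f : Vector ℕ N) →
                   sum (f ∘ p) ≡ sum f
sum-∘-involution p involutive f = sym (sum-permute f (permutation p p involutive involutive))

sum-updateAt : ∀ {N} (f : Vector ℕ N) k v → sum (updateAt f k (const v)) + f k ≡ sum f + v
sum-updateAt {suc N} f zero    v =
  solve 3 (λ v s x → (v :+ s) :+ x := (x :+ s) :+ v) refl v (sum (f ∘ suc)) (f zero)
sum-updateAt {suc N} f (suc k) v = begin
  f zero + sum (updateAt (f ∘ suc) k (const v)) + f (suc k)   ≡⟨ +-assoc (f zero) _ _ ⟩
  f zero + (sum (updateAt (f ∘ suc) k (const v)) + f (suc k)) ≡⟨ cong (f zero +_) (sum-updateAt (f ∘ suc) k v) ⟩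
  f zero + (sum (f ∘ suc) + v)                                ≡⟨ +-assoc (f zero) _ _ ⟨
  sum f + v                                                   ∎
  where open ≡-Reasoning

sum-single : ∀ {N} (f : Vector ℕ N) k → (∀ i → i ≢ k → f i ≡ 0) → sum f ≡ f k
sum-single f k others≡0 = begin
  sum f                                  ≡⟨ +-identityʳ (sum f) ⟨
  sum f + 0                              ≡⟨ sum-updateAt f k 0 ⟨
  sum (updateAt f k (const 0)) + f k     ≡⟨ cong (_+ f k) (sum-zero updated≡0) ⟩
  f k                                    ∎
  where
  open ≡-Reasoning
  updated≡0 : ∀ i → updateAt f k (const 0) i ≡ 0
  updated≡0 i with i Finₚ.≟ k
  ... | yes refl = updateAt-updates k f
  ... | no i≢k   = trans (updateAt-minimal i k f i≢k) (others≡0 i i≢k)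

sum-≤1 : ∀ {N} (f : Vector ℕ N) → (∀ i → f i ≤ 1) → (∀ i j → f i ≡ 1 → f j ≡ 1 → i ≡ j) → sum f ≤ 1
sum-≤1 {zero}  f f≤1 unique = z≤n
sum-≤1 {suc N} f f≤1 unique with n≤1⇒n≡0∨n≡1 (f≤1 zero)
... | inj₁ f0≡0 rewrite f0≡0 =
  sum-≤1 (f ∘ suc) (f≤1 ∘ suc) (λ i j fi≡1 fj≡1 → Finₚ.suc-injective (unique (suc i) (suc j) fi≡1 fj≡1))
... | inj₂ f0≡1 rewrite f0≡1 = ≤-reflexive (cong suc (sum-zero tail≡0))
  where
  tail≡0 : ∀ i → f (suc i) ≡ 0
  tail≡0 i with n≤1⇒n≡0∨n≡1 (f≤1 (suc i))
  ... | inj₁ fi≡0 = fi≡0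
  ... | inj₂ fi≡1 = contradiction (unique zero (suc i) f0≡1 fi≡1) Finₚ.0≢1+n

sum-agreeOutside : ∀ {N} {f g : Vector ℕ N} ks → Unique ks → (∀ i → i ∉ ks → f i ≡ g i) →
                   sum f + sumˡ (map g ks) ≡ sum g + sumˡ (map f ks)
sum-agreeOutside []       []                f≗g = cong (_+ 0) (sum-cong-≗ (λ i → f≗g i λ ()))
sum-agreeOutside {f = f} {g} (k ∷ ks) (k∉ks ∷ unique-ks) f≗g = +-cancelʳ-≡ (sum h) _ _ (begin
  sum f + (g k + sumˡ (map g ks)) + sum h
    ≡⟨ solve 4 (λ F H gk Gs → F :+ (gk :+ Gs) :+ H := (F :+ gk) :+ (H :+ Gs)) refl (sum f) (sum h) (g k) (sumˡ (map g ks)) ⟩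
  (sum f + g k) + (sum h + sumˡ (map g ks))
    ≡⟨ cong₂ _+_ (sym (sum-updateAt f k (g k))) (sum-agreeOutside {f = h} {g} ks unique-ks h≗g) ⟩
  (sum h + f k) + (sum g + sumˡ (map h ks))
    ≡⟨ cong (λ hs → (sum h + f k) + (sum g + sumˡ hs)) h≡f-on-ks ⟩
  (sum h + f k) + (sum g + sumˡ (map f ks))
    ≡⟨ solve 4 (λ G H fk Fs → (H :+ fk) :+ (G :+ Fs) := G :+ (fk :+ Fs) :+ H) refl (sum g) (sum h) (f k) (sumˡ (map f ks)) ⟩
  sum g + (f k + sumˡ (map f ks)) + sum h     ∎)
  where
  open ≡-Reasoning
  h : Vector ℕ _
  h = updateAt f k (const (g k))
  h≡f-on-ks : map h ks ≡ map f ks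
  h≡f-on-ks = map-cong-local (All.map (λ {i} k≢i → updateAt-minimal i k f (k≢i ∘ sym)) k∉ks)
  h≗g : ∀ i → i ∉ ks → h i ≡ g i
  h≗g i i∉ks with i Finₚ.≟ k
  ... | yes refl = updateAt-updates k f
  ... | no i≢k   = trans (updateAt-minimal i k f i≢k) (f≗g i λ { (here i≡k) → i≢k i≡k ; (there i∈ks) → i∉ks i∈ks })

sum-≤-agreeOutside : ∀ {N} {f g : Vector ℕ N} ks → Unique ks → (∀ i → i ∉ ks → f i ≡ g i) →
                     ∀ c → c + sumˡ (map f ks) ≤ sumˡ (map g ks) → c + sum f ≤ sum g
sum-≤-agreeOutside {f = f} {g} ks unique-ks f≗g c local≤ = +-cancelʳ-≤ (sumˡ (map f ks)) _ _ (begin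
  c + sum f + sumˡ (map f ks)    ≡⟨ solve 3 (λ c F Fs → c :+ F :+ Fs := F :+ (c :+ Fs)) refl c (sum f) (sumˡ (map f ks)) ⟩
  sum f + (c + sumˡ (map f ks))  ≤⟨ +-monoʳ-≤ (sum f) local≤ ⟩
  sum f + sumˡ (map g ks)        ≡⟨ sum-agreeOutside ks unique-ks f≗g ⟩
  sum g + sumˡ (map f ks)        ∎)
  where open ≤-Reasoning

𝟙[_] : ∀ {P : Set} → Dec P → ℕ
𝟙[ P? ] = if does P? then 1 else 0

𝟙-yes : ∀ {P : Set} (P? : Dec P) → P → 𝟙[ P? ] ≡ 1
𝟙-yes (yes _) _ = refl
𝟙-yes (no ¬p) p = contradiction p ¬p

𝟙-no : ∀ {P : Set} (P? : Dec P) → ¬ P → 𝟙[ P? ] ≡ 0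
𝟙-no (yes p) ¬p = contradiction p ¬p
𝟙-no (no _)  _  = refl

𝟙≤1 : ∀ {P : Set} (P? : Dec P) → 𝟙[ P? ] ≤ 1
𝟙≤1 (yes _) = ≤-refl
𝟙≤1 (no _)  = z≤n

𝟙≡1⇒ : ∀ {P : Set} (P? : Dec P) → 𝟙[ P? ] ≡ 1 → P
𝟙≡1⇒ (yes p) _ = p

𝟙+𝟙[¬]≡1 : ∀ {P : Set} (P? : Dec P) → 𝟙[ P? ] + 𝟙[ ¬? P? ] ≡ 1
𝟙+𝟙[¬]≡1 (yes _) = refl
𝟙+𝟙[¬]≡1 (no _)  = refl

transpose-matchˡ : ∀ {N} (i j : Fin N) → transpose i j i ≡ j
transpose-matchˡ i j rewrite dec-true (i Finₚ.≟ i) refl = refl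

transpose-matchʳ : ∀ {N} (i j : Fin N) → transpose i j j ≡ i
transpose-matchʳ i j with j Finₚ.≟ i
... | yes j≡i = j≡i
... | no _ rewrite dec-true (j Finₚ.≟ j) refl = refl

transpose-other : ∀ {N} {i j k : Fin N} → k ≢ i → k ≢ j → transpose i j k ≡ k
transpose-other {i = i} {j} {k} k≢i k≢j rewrite dec-false (k Finₚ.≟ i) k≢i | dec-false (k Finₚ.≟ j) k≢j = refl

-- Perfect matchings

IsMatching : ∀ {N} → (Fin N → Fin N) → Set
IsMatching p = (∀ i → p (p i) ≡ i) × (∀ i → p i ≢ i)

partner-involutive : ∀ {N} (M : PerfectMatching N) i → partner M (partner M i) ≡ i
partner-involutive M = proj₁ (proj₂ M)

partner-≢ : ∀ {N} (M : PerfectMatching N) i → partner M i ≢ i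
partner-≢ M = proj₂ (proj₂ M)

partner-injective : ∀ {N} (M : PerfectMatching N) {i j} → partner M i ≡ partner M j → i ≡ j
partner-injective M {i} {j} pi≡pj =
  trans (sym (partner-involutive M i)) (trans (cong (partner M) pi≡pj) (partner-involutive M j))

module _ {N : ℕ} (w : Fin N → Fin N → ℕ) where

  oriented : Fin N → Fin N → ℕ
  oriented i j = if does (toℕ i <? toℕ j) then w i j else 0

  oriented-split : (∀ i j → w i j ≡ w j i) → ∀ i j → i ≢ j → w i j ≡ oriented i j + oriented j i
  oriented-split w-sym i j i≢j with Finₚ.<-cmp i j
  ... | tri< i<j _ j≮i rewrite dec-true (toℕ i <? toℕ j) i<j | dec-false (toℕ j <? toℕ i) j≮i = sym (+-identityʳ _)
  ... | tri≈ _ i≡j _   = contradiction i≡j i≢j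
  ... | tri> i≮j _ j<i rewrite dec-false (toℕ i <? toℕ j) i≮j | dec-true (toℕ j <? toℕ i) j<i = w-sym i j

  2*edgeSum≡sum : (M : PerfectMatching N) → (∀ i j → w i j ≡ w j i) →
                  2 * edgeSum M w ≡ sum (λ i → w i (partner M i))
  2*edgeSum≡sum M w-sym = sym (begin
    sum (λ i → w i (p i))                                    ≡⟨ sum-cong-≗ (λ i → oriented-split w-sym i (p i) (partner-≢ M i ∘ sym)) ⟩
    sum (λ i → oriented i (p i) + oriented (p i) i)          ≡⟨ ∑-distrib-+ (λ i → oriented i (p i)) (λ i → oriented (p i) i) ⟩
    E + sum (λ i → oriented (p i) i)                         ≡⟨ cong (E +_) (sum-cong-≗ (λ i → cong (oriented (p i)) (partner-involutive M i))) ⟨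
    E + sum ((λ i → oriented i (p i)) ∘ p)                   ≡⟨ cong (E +_) (sum-∘-involution p (partner-involutive M) (λ i → oriented i (p i))) ⟩
    E + E                                                    ≡⟨ cong (E +_) (+-identityʳ E) ⟨
    E + (E + 0)                                              ≡⟨ cong (λ e → e + (e + 0)) (Σfin≡sum N (λ i → oriented i (p i))) ⟨
    2 * edgeSum M w                                          ∎)
    where
    open ≡-Reasoning
    p : Fin N → Fin N
    p = partner M
    E : ℕ
    E = sum (λ i → oriented i (p i))

edgeSum-cong : ∀ {N} (M M′ : PerfectMatching N) → (∀ i → partner M i ≡ partner M′ i) →
               (w : Fin N → Fin N → ℕ) → edgeSum M w ≡ edgeSum M′ w
edgeSum-cong {N} M M′ M≗M′ w = cong sumˡ (map-cong (λ i → cong (oriented w i) (M≗M′ i)) (allFin N))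

conjugate : ∀ {N} → Permutation N N → PerfectMatching N → PerfectMatching N
conjugate {N} π M = q , q-involutive , q≢id
  where
  p : Fin N → Fin N
  p = partner M
  q : Fin N → Fin N
  q i = π ⟨$⟩ʳ p (π ⟨$⟩ˡ i)
  q-involutive : ∀ i → q (q i) ≡ i
  q-involutive i = begin
    π ⟨$⟩ʳ p (π ⟨$⟩ˡ (π ⟨$⟩ʳ p (π ⟨$⟩ˡ i)))   ≡⟨ cong (λ x → π ⟨$⟩ʳ p x) (inverseˡ π) ⟩
    π ⟨$⟩ʳ p (p (π ⟨$⟩ˡ i))                    ≡⟨ cong (π ⟨$⟩ʳ_) (partner-involutive M (π ⟨$⟩ˡ i)) ⟩
    π ⟨$⟩ʳ (π ⟨$⟩ˡ i)                          ≡⟨ inverseʳ π ⟩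
    i                                          ∎
    where open ≡-Reasoning
  q≢id : ∀ i → q i ≢ i
  q≢id i qi≡i = partner-≢ M (π ⟨$⟩ˡ i) (trans (sym (inverseˡ π)) (cong (π ⟨$⟩ˡ_) qi≡i))

-- Conjugating by the transposition of p i and j replaces the pairs {i, p i}, {j, p j}
-- by {i, j}, {p i, p j} and keeps all other pairs.
module _ {N} (M : PerfectMatching N) {i j : Fin N} (i≢j : i ≢ j) (pi≢j : partner M i ≢ j) where

  private
    p σ : Fin N → Fin N
    p = partner M
    σ = transpose (p i) j
    i≢pi : i ≢ p i
    i≢pi = partner-≢ M i ∘ sym
    j≢pj : j ≢ p j
    j≢pj = partner-≢ M j ∘ sym
    i≢pj : i ≢ p j
    i≢pj i≡pj = pi≢j (trans (cong p i≡pj) (partner-involutive M j))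
    pj≢pi : p j ≢ p i
    pj≢pi = i≢j ∘ sym ∘ partner-injective M

  rematch : PerfectMatching N
  rematch = conjugate (Perm.transpose (p i) j) M

  rematch-unique : Unique (i ∷ j ∷ p i ∷ p j ∷ [])
  rematch-unique = (i≢j ∷ i≢pi ∷ i≢pj ∷ []) ∷ ((pi≢j ∘ sym) ∷ j≢pj ∷ []) ∷ ((pj≢pi ∘ sym) ∷ []) ∷ [] ∷ []

  rematch-i : partner rematch i ≡ j
  rematch-i = trans (cong (σ ∘ p) (transpose-other i≢j i≢pi)) (transpose-matchˡ (p i) j)

  rematch-j : partner rematch j ≡ i
  rematch-j = trans (cong (σ ∘ p) (transpose-matchˡ j (p i)))
                    (trans (cong σ (partner-involutive M i)) (transpose-other i≢pi i≢j))

  rematch-pi : partner rematch (p i) ≡ p j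
  rematch-pi = trans (cong (σ ∘ p) (transpose-matchʳ j (p i))) (transpose-other pj≢pi (j≢pj ∘ sym))

  rematch-pj : partner rematch (p j) ≡ p i
  rematch-pj = trans (cong (σ ∘ p) (transpose-other (j≢pj ∘ sym) pj≢pi))
                     (trans (cong σ (partner-involutive M j)) (transpose-matchʳ (p i) j))

  rematch-other : ∀ x → x ∉ (i ∷ j ∷ p i ∷ p j ∷ []) → partner rematch x ≡ p x
  rematch-other x x∉ = trans (cong (σ ∘ p) (transpose-other (x∉ ∘ there ∘ here) (x∉ ∘ there ∘ there ∘ here)))
    (transpose-other (x∉ ∘ here ∘ partner-injective M)
                     (λ px≡j → x∉ (there (there (there (here (trans (sym (partner-involutive M x)) (cong p px≡j))))))))

IsMatching? : ∀ {N} (p : Fin N → Fin N) → Dec (IsMatching p)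
IsMatching? p = Finₚ.all? (λ i → p (p i) Finₚ.≟ i) ×-dec Finₚ.all? (λ i → ¬? (p i Finₚ.≟ i))

IsMatching-resp-≗ : ∀ {N} {p q : Fin N → Fin N} → (∀ i → q i ≡ p i) → IsMatching p → IsMatching q
IsMatching-resp-≗ {p = p} {q} q≗p (involutive , p≢id) =
  (λ i → trans (cong q (q≗p i)) (trans (q≗p (p i)) (involutive i))) ,
  (λ i qi≡i → p≢id i (trans (sym (q≗p i)) qi≡i))

vectors : ∀ N k → List (Vec (Fin N) k)
vectors N zero    = [] ∷ []
vectors N (suc k) = cartesianProductWith _∷_ (allFin N) (vectors N k)

∈-vectors : ∀ {N k} (v : Vec (Fin N) k) → v ∈ vectors N k
∈-vectors []      = here refl
∈-vectors (i ∷ v) = ∈-cartesianProductWith⁺ _∷_ (∈-allFin i) (∈-vectors v)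

toMatching : ∀ {N} → Vec (Fin N) N → Maybe (PerfectMatching N)
toMatching v with IsMatching? (lookup v)
... | yes matching = just (lookup v , matching)
... | no _         = nothing

perfectMatchings : ∀ N → List (PerfectMatching N)
perfectMatchings N = mapMaybe toMatching (vectors N N)

perfectMatchings-complete : ∀ {N} (M : PerfectMatching N) →
                            Any (λ M′ → ∀ i → partner M′ i ≡ partner M i) (perfectMatchings N)
perfectMatchings-complete {N} M =
  Anyₚ.mapMaybe⁺ toMatching (vectors N N) (Anyₚ.gmap (λ { refl → toMatching-tabulate }) (∈-vectors (tabulateᵛ p)))
  where
  p : Fin N → Fin N
  p = partner M
  toMatching-tabulate : Maybe.Any (λ M′ → ∀ i → partner M′ i ≡ p i) (toMatching (tabulateᵛ p))
  toMatching-tabulate with IsMatching? (lookup (tabulateᵛ p))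
  ... | yes _        = Maybe.just (lookup∘tabulate p)
  ... | no ¬matching = contradiction (IsMatching-resp-≗ (lookup∘tabulate p) (proj₂ M)) ¬matching

swapAdjacent : ∀ m → Fin (m * 2) → Fin (m * 2)
swapAdjacent (suc m) zero          = suc zero
swapAdjacent (suc m) (suc zero)    = zero
swapAdjacent (suc m) (suc (suc i)) = suc (suc (swapAdjacent m i))

swapAdjacent-isMatching : ∀ m → IsMatching (swapAdjacent m)
swapAdjacent-isMatching m = involutive m , ≢id m
  where
  involutive : ∀ m i → swapAdjacent m (swapAdjacent m i) ≡ i
  involutive (suc m) zero          = refl
  involutive (suc m) (suc zero)    = refl
  involutive (suc m) (suc (suc i)) = cong (λ k → suc (suc k)) (involutive m i)
  ≢id : ∀ m i → swapAdjacent m i ≢ i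
  ≢id (suc m) zero          ()
  ≢id (suc m) (suc zero)    ()
  ≢id (suc m) (suc (suc i)) eq = ≢id m i (Finₚ.suc-injective (Finₚ.suc-injective eq))

-- The recursion is on m * 2 because suc m * 2 reduces to suc (suc (m * 2)); 2 * suc m does not.
pairing : ∀ m → PerfectMatching (2 * m)
pairing m = subst PerfectMatching (*-comm m 2) (swapAdjacent m , swapAdjacent-isMatching m)

lexicographicOptimum : ∀ {A : Set} (f g : A → ℕ) (xs : List A) →
                       (∀ a → Any (λ x → f x ≡ f a × g x ≡ g a) xs) → A →
                       Σ A λ b → (∀ a → f b ≤ f a) × (∀ a → f a ≤ f b → g a ≤ g b)
lexicographicOptimum {A} f g xs complete a₀ = b , f-minimal , g-maximal
  where
  b₁ : A
  b₁ = argmin f a₀ xs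
  f-minimal₁ : ∀ a → f b₁ ≤ f a
  f-minimal₁ a = f[argmin]≤v⁺ a₀ xs (inj₂ (Any.map (≤-reflexive ∘ proj₁) (complete a)))
  ties : List A
  ties = filter (λ x → f x ≟ f b₁) xs
  b : A
  b = argmax g b₁ ties
  fb≡fb₁ : f b ≡ f b₁
  fb≡fb₁ = argmax-all g {P = λ x → f x ≡ f b₁} refl (all-filter (λ x → f x ≟ f b₁) xs)
  f-minimal : ∀ a → f b ≤ f a
  f-minimal a = subst (_≤ f a) (sym fb≡fb₁) (f-minimal₁ a)
  g-maximal : ∀ a → f a ≤ f b → g a ≤ g b
  g-maximal a fa≤fb with find (complete a)
  ... | x , x∈xs , fx≡fa , gx≡ga = v≤f[argmax]⁺ b₁ ties (inj₂ (lose x∈ties (≤-reflexive (sym gx≡ga))))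
    where
    x∈ties : x ∈ ties
    x∈ties = ∈-filter⁺ (λ x → f x ≟ f b₁) x∈xs
               (≤-antisym (≤-trans (≤-reflexive fx≡fa) (subst (f a ≤_) fb≡fb₁ fa≤fb)) (f-minimal₁ x))

-- Binary vectors

⊔v-comm : ∀ {n} (x y : BVec n) → x ⊔v y ≡ y ⊔v x
⊔v-comm = zipWith-comm Boolₚ.∨-comm

⊔v-idem : ∀ {n} (x : BVec n) → x ⊔v x ≡ x
⊔v-idem = zipWith-idem Boolₚ.∨-idem

∣x∣+∣a⊔b∣≤∣x⊔a∣+∣x⊔b∣ : ∀ {n} (x a b : BVec n) → ∣ x ∣v + ∣ a ⊔v b ∣v ≤ ∣ x ⊔v a ∣v + ∣ x ⊔v b ∣v
∣x∣+∣a⊔b∣≤∣x⊔a∣+∣x⊔b∣ [] [] [] = z≤n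
∣x∣+∣a⊔b∣≤∣x⊔a∣+∣x⊔b∣ (false ∷ x) (false ∷ a) (false ∷ b) = ∣x∣+∣a⊔b∣≤∣x⊔a∣+∣x⊔b∣ x a b
∣x∣+∣a⊔b∣≤∣x⊔a∣+∣x⊔b∣ (false ∷ x) (true ∷ a) (false ∷ b)
  rewrite +-suc ∣ x ∣v ∣ a ⊔v b ∣v = s≤s (∣x∣+∣a⊔b∣≤∣x⊔a∣+∣x⊔b∣ x a b)
∣x∣+∣a⊔b∣≤∣x⊔a∣+∣x⊔b∣ (false ∷ x) (false ∷ a) (true ∷ b)
  rewrite +-suc ∣ x ∣v ∣ a ⊔v b ∣v | +-suc ∣ x ⊔v a ∣v ∣ x ⊔v b ∣v = s≤s (∣x∣+∣a⊔b∣≤∣x⊔a∣+∣x⊔b∣ x a b)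
∣x∣+∣a⊔b∣≤∣x⊔a∣+∣x⊔b∣ (false ∷ x) (true ∷ a) (true ∷ b)
  rewrite +-suc ∣ x ∣v ∣ a ⊔v b ∣v | +-suc ∣ x ⊔v a ∣v ∣ x ⊔v b ∣v = s≤s (m≤n⇒m≤1+n (∣x∣+∣a⊔b∣≤∣x⊔a∣+∣x⊔b∣ x a b))
∣x∣+∣a⊔b∣≤∣x⊔a∣+∣x⊔b∣ (true ∷ x) (false ∷ a) (false ∷ b)
  rewrite +-suc ∣ x ⊔v a ∣v ∣ x ⊔v b ∣v = s≤s (m≤n⇒m≤1+n (∣x∣+∣a⊔b∣≤∣x⊔a∣+∣x⊔b∣ x a b))
∣x∣+∣a⊔b∣≤∣x⊔a∣+∣x⊔b∣ (true ∷ x) (true ∷ a) (false ∷ b)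
  rewrite +-suc ∣ x ∣v ∣ a ⊔v b ∣v | +-suc ∣ x ⊔v a ∣v ∣ x ⊔v b ∣v = s≤s (s≤s (∣x∣+∣a⊔b∣≤∣x⊔a∣+∣x⊔b∣ x a b))
∣x∣+∣a⊔b∣≤∣x⊔a∣+∣x⊔b∣ (true ∷ x) (false ∷ a) (true ∷ b)
  rewrite +-suc ∣ x ∣v ∣ a ⊔v b ∣v | +-suc ∣ x ⊔v a ∣v ∣ x ⊔v b ∣v = s≤s (s≤s (∣x∣+∣a⊔b∣≤∣x⊔a∣+∣x⊔b∣ x a b))
∣x∣+∣a⊔b∣≤∣x⊔a∣+∣x⊔b∣ (true ∷ x) (true ∷ a) (true ∷ b)
  rewrite +-suc ∣ x ∣v ∣ a ⊔v b ∣v | +-suc ∣ x ⊔v a ∣v ∣ x ⊔v b ∣v = s≤s (s≤s (∣x∣+∣a⊔b∣≤∣x⊔a∣+∣x⊔b∣ x a b))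

∣x⊔x∣+∣a⊔b∣≤∣x⊔a∣+∣x⊔b∣ : ∀ {n} (x a b : BVec n) → ∣ x ⊔v x ∣v + ∣ a ⊔v b ∣v ≤ ∣ x ⊔v a ∣v + ∣ x ⊔v b ∣v
∣x⊔x∣+∣a⊔b∣≤∣x⊔a∣+∣x⊔b∣ x a b rewrite ⊔v-idem x = ∣x∣+∣a⊔b∣≤∣x⊔a∣+∣x⊔b∣ x a b
-- Identical pairs

module Identical {A : Set} (_≟_ : DecidableEquality A) {N : ℕ} (u : Fin N → A) where

  same : Fin N → Fin N → ℕ
  same x y = 𝟙[ u x ≟ u y ]

  differ : Fin N → Fin N → ℕ
  differ x y = 𝟙[ ¬? (u x ≟ u y) ]

  same-sym : ∀ x y → same x y ≡ same y x
  same-sym x y with u x ≟ u y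
  ... | yes ux≡uy = sym (𝟙-yes (u y ≟ u x) (sym ux≡uy))
  ... | no ux≢uy  = sym (𝟙-no (u y ≟ u x) (ux≢uy ∘ sym))

  identical : PerfectMatching N → ℕ
  identical M = edgeSum M same

  Stray : PerfectMatching N → Fin N → Set
  Stray M x = u (partner M x) ≢ u x

  AtMostOneStrayPerClass : PerfectMatching N → Set
  AtMostOneStrayPerClass M = ∀ x y → u x ≡ u y → Stray M x → Stray M y → x ≡ y

  strays : PerfectMatching N → ℕ
  strays M = sum (λ x → differ x (partner M x))

  2*identical+strays≡N : ∀ M → 2 * identical M + strays M ≡ N
  2*identical+strays≡N M = begin
    2 * identical M + strays M                             ≡⟨ cong (_+ strays M) (2*edgeSum≡sum same M same-sym) ⟩
    sum (λ x → same x (p x)) + strays M                   ≡⟨ ∑-distrib-+ (λ x → same x (p x)) (λ x → differ x (p x)) ⟨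
    sum (λ x → same x (p x) + differ x (p x))             ≡⟨ sum-cong-≗ (λ x → 𝟙+𝟙[¬]≡1 (u x ≟ u (p x))) ⟩
    sum {N} (const 1)                                      ≡⟨ sum-const-1 N ⟩
    N                                                      ∎
    where
    open ≡-Reasoning
    p : Fin N → Fin N
    p = partner M

  straysLike : PerfectMatching N → Fin N → ℕ
  straysLike M x = sum (λ y → same x y * differ y (partner M y))

  withinClass : Fin N → Fin N → Fin N → ℕ
  withinClass x a b = same x a * same a b

  withinClass-sym : ∀ x a b → withinClass x a b ≡ withinClass x b a
  withinClass-sym x a b with u a ≟ u b
  ... | yes ua≡ub = cong₂ _*_ (cong (λ v → 𝟙[ u x ≟ v ]) ua≡ub) (sym (𝟙-yes (u b ≟ u a) (sym ua≡ub)))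
  ... | no ua≢ub  = trans (*-zeroʳ (same x a)) (sym (trans (cong (same x b *_) (𝟙-no (u b ≟ u a) (ua≢ub ∘ sym))) (*-zeroʳ (same x b))))

  classSize-parity : ∀ M x → sum (same x) ≡ straysLike M x + 2 * edgeSum M (withinClass x)
  classSize-parity M x = begin
    sum (same x)                                                       ≡⟨ sum-cong-≗ split ⟩
    sum (λ y → same x y * differ y (p y) + same x y * same y (p y))    ≡⟨ ∑-distrib-+ (λ y → same x y * differ y (p y)) (λ y → same x y * same y (p y)) ⟩
    straysLike M x + sum (λ y → withinClass x y (p y))                 ≡⟨ cong (straysLike M x +_) (2*edgeSum≡sum (withinClass x) M (withinClass-sym x)) ⟨
    straysLike M x + 2 * edgeSum M (withinClass x)                     ∎
    where
    open ≡-Reasoning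
    p : Fin N → Fin N
    p = partner M
    split : ∀ y → same x y ≡ same x y * differ y (p y) + same x y * same y (p y)
    split y = sym (begin
      same x y * differ y (p y) + same x y * same y (p y)  ≡⟨ *-distribˡ-+ (same x y) _ _ ⟨
      same x y * (differ y (p y) + same y (p y))           ≡⟨ cong (same x y *_) (+-comm (differ y (p y)) _) ⟩
      same x y * (same y (p y) + differ y (p y))           ≡⟨ cong (same x y *_) (𝟙+𝟙[¬]≡1 (u y ≟ u (p y))) ⟩
      same x y * 1                                         ≡⟨ *-identityʳ _ ⟩
      same x y                                             ∎)

  straysLike≤1 : ∀ M → AtMostOneStrayPerClass M → ∀ x → straysLike M x ≤ 1
  straysLike≤1 M atMostOne x = sum-≤1 f f≤1 f≡1-unique
    where
    p : Fin N → Fin N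
    p = partner M
    f : Fin N → ℕ
    f y = same x y * differ y (p y)
    f≤1 : ∀ y → f y ≤ 1
    f≤1 y = *-mono-≤ (𝟙≤1 (u x ≟ u y)) (𝟙≤1 (¬? (u y ≟ u (p y))))
    sameClassStray : ∀ y → f y ≡ 1 → u x ≡ u y × Stray M y
    sameClassStray y fy≡1 = 𝟙≡1⇒ (u x ≟ u y) (m*n≡1⇒m≡1 _ _ fy≡1) ,
                            𝟙≡1⇒ (¬? (u y ≟ u (p y))) (m*n≡1⇒n≡1 (same x y) _ fy≡1) ∘ sym
    f≡1-unique : ∀ y z → f y ≡ 1 → f z ≡ 1 → y ≡ z
    f≡1-unique y z fy≡1 fz≡1 with sameClassStray y fy≡1 | sameClassStray z fz≡1
    ... | ux≡uy , stray-y | ux≡uz , stray-z = atMostOne y z (trans (sym ux≡uy) ux≡uz) stray-y stray-z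

  straysLike-minimal : ∀ M M′ → AtMostOneStrayPerClass M → ∀ x → straysLike M x ≤ straysLike M′ x
  straysLike-minimal M M′ atMostOne x with n≤1⇒n≡0∨n≡1 (straysLike≤1 M atMostOne x)
  ... | inj₁ T≡0 = subst (_≤ straysLike M′ x) (sym T≡0) z≤n
  ... | inj₂ T≡1 = subst (_≤ straysLike M′ x) (sym T≡1) (n≢0⇒n>0 T′≢0)
    where
    T′≢0 : straysLike M′ x ≢ 0
    T′≢0 T′≡0 = even≢odd (edgeSum M′ (withinClass x)) (edgeSum M (withinClass x)) (begin
      2 * edgeSum M′ (withinClass x)                     ≡⟨ cong (_+ 2 * edgeSum M′ (withinClass x)) T′≡0 ⟨
      straysLike M′ x + 2 * edgeSum M′ (withinClass x)   ≡⟨ classSize-parity M′ x ⟨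
      sum (same x)                                       ≡⟨ classSize-parity M x ⟩
      straysLike M x + 2 * edgeSum M (withinClass x)     ≡⟨ cong (_+ 2 * edgeSum M (withinClass x)) T≡1 ⟩
      suc (2 * edgeSum M (withinClass x))                ∎)
      where open ≡-Reasoning

  Leader : Fin N → Set
  Leader x = ∀ y → y Fin.< x → u y ≢ u x

  leader? : ∀ x → Dec (Leader x)
  leader? x = Finₚ.all? (λ y → y Finₚ.<? x →-dec ¬? (u y ≟ u x))

  leader-exists : ∀ y → Σ (Fin N) λ r → Leader r × u r ≡ u y
  leader-exists y = go y (Finᵢ.<-wellFounded y)
    where
    go : ∀ y → Acc Fin._<_ y → Σ (Fin N) λ r → Leader r × u r ≡ u y
    go y (acc earlier) with Finₚ.any? (λ z → z Finₚ.<? y ×-dec (u z ≟ u y))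
    ... | yes (z , z<y , uz≡uy) with go z (earlier z<y)
    ...   | r , leader-r , ur≡uz = r , leader-r , trans ur≡uz uz≡uy
    go y (acc earlier) | no ¬earlier = y , (λ z z<y uz≡uy → ¬earlier (z , z<y , uz≡uy)) , refl

  leader-unique : ∀ {r s} → Leader r → Leader s → u r ≡ u s → r ≡ s
  leader-unique {r} {s} leader-r leader-s ur≡us with Finₚ.<-cmp r s
  ... | tri< r<s _ _ = contradiction ur≡us (leader-s r r<s)
  ... | tri≈ _ r≡s _ = r≡s
  ... | tri> _ _ s<r = contradiction (sym ur≡us) (leader-r s s<r)

  leader : Fin N → ℕ
  leader x = 𝟙[ leader? x ]

  sum-leader*same≡1 : ∀ y → sum (λ x → leader x * same x y) ≡ 1
  sum-leader*same≡1 y with leader-exists y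
  ... | r , leader-r , ur≡uy = trans (sum-single _ r others≡0)
                                     (cong₂ _*_ (𝟙-yes (leader? r) leader-r) (𝟙-yes (u r ≟ u y) ur≡uy))
    where
    others≡0 : ∀ x → x ≢ r → leader x * same x y ≡ 0
    others≡0 x x≢r with u x ≟ u y
    ... | yes ux≡uy = cong (_* 1) (𝟙-no (leader? x) λ leader-x → x≢r (leader-unique leader-x leader-r (trans ux≡uy (sym ur≡uy))))
    ... | no _      = *-zeroʳ (leader x)

  strays≡sum-leader*straysLike : ∀ M → strays M ≡ sum (λ x → leader x * straysLike M x)
  strays≡sum-leader*straysLike M = begin
    sum d                                                   ≡⟨ sum-cong-≗ (λ y → trans (cong (d y *_) (sum-leader*same≡1 y)) (*-identityʳ (d y))) ⟨
    sum (λ y → d y * sum (λ x → leader x * same x y))       ≡⟨ sum-cong-≗ (λ y → *-distribˡ-sum (d y) (λ x → leader x * same x y)) ⟩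
    sum (λ y → sum (λ x → d y * (leader x * same x y)))     ≡⟨ ∑-comm (λ y x → d y * (leader x * same x y)) ⟩
    sum (λ x → sum (λ y → d y * (leader x * same x y)))     ≡⟨ sum-cong-≗ (λ x → sum-cong-≗ (λ y → rearrange (d y) (leader x) (same x y))) ⟩
    sum (λ x → sum (λ y → leader x * (same x y * d y)))     ≡⟨ sum-cong-≗ (λ x → *-distribˡ-sum (leader x) (λ y → same x y * d y)) ⟨
    sum (λ x → leader x * straysLike M x)                   ∎
    where
    open ≡-Reasoning
    d : Fin N → ℕ
    d y = differ y (partner M y)
    rearrange : ∀ a b c → a * (b * c) ≡ b * (c * a)
    rearrange = solve 3 (λ a b c → a :* (b :* c) := b :* (c :* a)) refl

  identical-maximal : ∀ M M′ → AtMostOneStrayPerClass M → identical M′ ≤ identical M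
  identical-maximal M M′ atMostOne = *-cancelˡ-≤ 2 (+-cancelʳ-≤ (strays M) _ _ (begin
    2 * identical M′ + strays M     ≤⟨ +-monoʳ-≤ (2 * identical M′) strays-minimal ⟩
    2 * identical M′ + strays M′    ≡⟨ 2*identical+strays≡N M′ ⟩
    N                               ≡⟨ 2*identical+strays≡N M ⟨
    2 * identical M + strays M      ∎))
    where
    open ≤-Reasoning
    strays-minimal : strays M ≤ strays M′
    strays-minimal = subst₂ _≤_ (sym (strays≡sum-leader*straysLike M)) (sym (strays≡sum-leader*straysLike M′))
      (sum-mono-≤ (λ x → *-monoʳ-≤ (leader x) (straysLike-minimal M M′ atMostOne x)))

-- The exchange argument

module MinimumCost {A : Set} (_≟_ : DecidableEquality A) (c : A → A → ℕ)
                   (c-sym : ∀ a b → c a b ≡ c b a)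
                   (c-exchange : ∀ x a b → c x x + c a b ≤ c x a + c x b)
                   {N : ℕ} (u : Fin N → A) where

  open Identical _≟_ u

  C : Fin N → Fin N → ℕ
  C x y = c (u x) (u y)

  C-sym : ∀ x y → C x y ≡ C y x
  C-sym x y = c-sym (u x) (u y)

  cost : PerfectMatching N → ℕ
  cost M = edgeSum M C

  exchange : ∀ M {i j} → i ≢ j → u i ≡ u j → Stray M i → Stray M j →
             Σ (PerfectMatching N) λ M′ → cost M′ ≤ cost M × identical M < identical M′
  exchange M {i} {j} i≢j ui≡uj stray-i stray-j = M′ , cost-M′≤cost-M , identical-M<identical-M′
    where
    p : Fin N → Fin N
    p = partner M
    pi≢j : p i ≢ j
    pi≢j pi≡j = stray-i (trans (cong u pi≡j) (sym ui≡uj))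
    M′ : PerfectMatching N
    M′ = rematch M i≢j pi≢j
    q : Fin N → Fin N
    q = partner M′
    ks : List (Fin N)
    ks = i ∷ j ∷ p i ∷ p j ∷ []

    outside : ∀ F x → x ∉ ks → F x (q x) ≡ F x (p x)
    outside F x x∉ks = cong (F x) (rematch-other M i≢j pi≢j x x∉ks)

    before : ∀ F → sumˡ (map (λ x → F x (p x)) ks) ≡ F i (p i) + (F j (p j) + (F (p i) i + (F (p j) j + 0)))
    before F = cong (λ k → F i (p i) + (F j (p j) + k))
                    (cong₂ (λ k l → F (p i) k + (F (p j) l + 0)) (partner-involutive M i) (partner-involutive M j))

    after : ∀ F → sumˡ (map (λ x → F x (q x)) ks) ≡ F i j + (F j i + (F (p i) (p j) + (F (p j) (p i) + 0)))
    after F = cong₂ _+_ (cong (F i) (rematch-i M i≢j pi≢j))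
             (cong₂ _+_ (cong (F j) (rematch-j M i≢j pi≢j))
             (cong₂ _+_ (cong (F (p i)) (rematch-pi M i≢j pi≢j))
                        (cong (λ k → F (p j) k + 0) (rematch-pj M i≢j pi≢j))))

    local-cost≤ : 0 + sumˡ (map (λ x → C x (q x)) ks) ≤ sumˡ (map (λ x → C x (p x)) ks)
    local-cost≤ = begin
      sumˡ (map (λ x → C x (q x)) ks)                          ≡⟨ after C ⟩
      C i j + (C j i + (C (p i) (p j) + (C (p j) (p i) + 0)))  ≡⟨ values-after ⟩
      c x x + (c x x + (c a b + (c a b + 0)))                  ≤⟨ twice (c x x) (c a b) (c x a) (c x b) (c-exchange x a b) ⟩
      c x a + (c x b + (c x a + (c x b + 0)))                  ≡⟨ values-before ⟩
      C i (p i) + (C j (p j) + (C (p i) i + (C (p j) j + 0)))  ≡⟨ before C ⟨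
      sumˡ (map (λ x → C x (p x)) ks)                          ∎
      where
      open ≤-Reasoning
      x a b : A
      x = u i
      a = u (p i)
      b = u (p j)
      values-after : C i j + (C j i + (C (p i) (p j) + (C (p j) (p i) + 0))) ≡ c x x + (c x x + (c a b + (c a b + 0)))
      values-after = cong₂ _+_ (cong (c x) (sym ui≡uj))
                    (cong₂ _+_ (cong (λ y → c y x) (sym ui≡uj))
                               (cong (λ k → c a b + (k + 0)) (c-sym b a)))
      values-before : c x a + (c x b + (c x a + (c x b + 0))) ≡ C i (p i) + (C j (p j) + (C (p i) i + (C (p j) j + 0)))
      values-before = cong (c x a +_) (cong₂ _+_ (cong (λ y → c y b) ui≡uj)
                                      (cong₂ _+_ (c-sym x a) (cong (_+ 0) (trans (c-sym x b) (cong (c b) ui≡uj)))))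
      twice : ∀ k l m n → k + l ≤ m + n → k + (k + (l + (l + 0))) ≤ m + (n + (m + (n + 0)))
      twice k l m n k+l≤m+n = subst₂ _≤_
        (solve 2 (λ k l → (k :+ l) :+ (k :+ l) := k :+ (k :+ (l :+ (l :+ con 0)))) refl k l)
        (solve 2 (λ m n → (m :+ n) :+ (m :+ n) := m :+ (n :+ (m :+ (n :+ con 0)))) refl m n)
        (+-mono-≤ k+l≤m+n k+l≤m+n)

    local-identical≥ : 2 + sumˡ (map (λ x → same x (p x)) ks) ≤ sumˡ (map (λ x → same x (q x)) ks)
    local-identical≥ = begin
      2 + sumˡ (map (λ x → same x (p x)) ks)   ≡⟨ cong (2 +_) (trans (before same) strays-unpaired) ⟩
      2                                        ≤⟨ s≤s (s≤s z≤n) ⟩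
      1 + (1 + R)                              ≡⟨ cong₂ (λ k l → k + (l + R)) (𝟙-yes (u i ≟ u j) ui≡uj) (𝟙-yes (u j ≟ u i) (sym ui≡uj)) ⟨
      same i j + (same j i + R)                ≡⟨ after same ⟨
      sumˡ (map (λ x → same x (q x)) ks)       ∎
      where
      open ≤-Reasoning
      R : ℕ
      R = same (p i) (p j) + (same (p j) (p i) + 0)
      strays-unpaired : same i (p i) + (same j (p j) + (same (p i) i + (same (p j) j + 0))) ≡ 0
      strays-unpaired =
        cong₂ _+_ (𝟙-no (u i ≟ u (p i)) (stray-i ∘ sym))
       (cong₂ _+_ (𝟙-no (u j ≟ u (p j)) (stray-j ∘ sym))
       (cong₂ _+_ (𝟙-no (u (p i) ≟ u i) stray-i)
                  (cong (_+ 0) (𝟙-no (u (p j) ≟ u j) stray-j))))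

    cost-M′≤cost-M : cost M′ ≤ cost M
    cost-M′≤cost-M = *-cancelˡ-≤ 2 (subst₂ _≤_ (sym (2*edgeSum≡sum C M′ C-sym)) (sym (2*edgeSum≡sum C M C-sym))
      (sum-≤-agreeOutside ks (rematch-unique M i≢j pi≢j) (outside C) 0 local-cost≤))

    identical-M<identical-M′ : identical M < identical M′
    identical-M<identical-M′ = *-cancelˡ-≤ 2 (subst₂ _≤_
      (sym (trans (*-suc 2 (identical M)) (cong (2 +_) (2*edgeSum≡sum same M same-sym))))
      (sym (2*edgeSum≡sum same M′ same-sym))
      (sum-≤-agreeOutside ks (rematch-unique M i≢j pi≢j) (λ x x∉ks → sym (outside same x x∉ks)) 2 local-identical≥))

  optimal⇒atMostOneStrayPerClass : ∀ M → (∀ M′ → cost M′ ≤ cost M → identical M′ ≤ identical M) →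
                                   AtMostOneStrayPerClass M
  optimal⇒atMostOneStrayPerClass M optimal x y ux≡uy stray-x stray-y with x Finₚ.≟ y
  ... | yes x≡y = x≡y
  ... | no x≢y with exchange M x≢y ux≡uy stray-x stray-y
  ...   | M′ , cost≤ , identical< = contradiction (optimal M′ cost≤) (<⇒≱ identical<)

  perfectMatchings-realise : ∀ M → Any (λ M′ → cost M′ ≡ cost M × identical M′ ≡ identical M) (perfectMatchings N)
  perfectMatchings-realise M =
    Any.map (λ {M′} M′≗M → edgeSum-cong M′ M M′≗M C , edgeSum-cong M′ M M′≗M same) (perfectMatchings-complete M)

  minimumCost-maximumIdentical : PerfectMatching N →
    Σ (PerfectMatching N) λ M → (∀ M′ → cost M ≤ cost M′) × (∀ M′ → identical M′ ≤ identical M)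
  minimumCost-maximumIdentical M₀ =
    let M , cost-minimal , optimal = lexicographicOptimum cost identical (perfectMatchings N) perfectMatchings-realise M₀
    in  M , cost-minimal , λ M′ → identical-maximal M M′ (optimal⇒atMostOneStrayPerClass M optimal)

lemma3 : (n m : ℕ) (u : Fin (2 * m) → BVec n) →
    Σ (PerfectMatching (2 * m)) λ M →
      ((M' : PerfectMatching (2 * m)) → weight u M ≤ weight u M')
      × ((M' : PerfectMatching (2 * m)) → identicalPairs u M' ≤ identicalPairs u M)
lemma3 n m u = minimumCost-maximumIdentical (pairing m)
  where
  open MinimumCost (≡-dec Boolₚ._≟_) (λ a b → ∣ a ⊔v b ∣v) (λ a b → cong ∣_∣v (⊔v-comm a b))
                   ∣x⊔x∣+∣a⊔b∣≤∣x⊔a∣+∣x⊔b∣ u
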